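{- There is a fixed function $f:\mathbb N\times\mathbb N\to\mathbb N$, exponential in both arguments (i.e. $f(n,k)\le 2^{p(n,k)}$ for some polynomial $p$), such that for every word or $\omega$-word $\mathfrak M$ over a signature $\sigma_0\cup\{\mathrm{succ},<\}$ and every natural number $k>0$, the number of distinct $k$-profiles realized by elements of $\mathfrak M$ is at most $f(|\sigma_0|,k)$.
   Context: A word is a finite structure over $\sigma_0\cup\{\mathrm{succ},<\}$, $\sigma_0$ a finite set of unary relation symbols, $<$ a strict linear order and $\mathrm{succ}$ its induced successor; an $\omega$-word is an infinite such structure whose $\{\mathrm{succ},<\}$-reduct is isomorphic to $(\mathbb N,+1,<)$. For a tuple $a_1,\dots,a_s$ of elements, its type $\mathrm{tp}(a_1,\dots,a_s)$ is the set of all atomic and negated atomic formulas (over $\sigma_0$, $\mathrm{succ}$, $<$, $=$) in variables $x_1,\dots,x_s$ true in $\mathfrak M$ under $x_i\mapsto a_i$. The $k$-profile of $a\in M$ is the triple $(\mathcal F,\mathcal L,\mathcal R)$ where $\mathcal F$ is the set of types of all tuples $a_1,\dots,a_s$ with $1\le s\le k$ and $a_1=a$; $\mathcal L$ is the set of types of such tuples with additionally $a_i<a$ for all $2\le i\le s$; $\mathcal R$ is the set of types of such tuples with additionally $a<a_i$ for all $2\le i\le s$. -}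

module Defs where

open import Data.Nat using (ℕ; zero; suc; _+_; _*_; _^_; _≤_; _<_; _<?_; _≟_)
open import Data.Fin using (Fin; toℕ) renaming (zero to fzero; suc to fsuc)
open import Data.Bool using (Bool; not)
open import Data.List using (List; []; _∷_)
open import Data.Product using (Σ; _×_; _,_)
open import Relation.Nullary using (¬_)
open import Relation.Nullary.Decidable using (⌊_⌋)
open import Relation.Binary.PropositionalEquality using (_≡_; _≢_; _≗_)

-- Words and ω-words over σ₀ ∪ {succ, <}, where σ₀ = Fin n (n unary symbols).
-- A unary symbol r ∈ σ₀ is interpreted by the characteristic function
-- of the relation P_r.

data Word (n : ℕ) : Set where
  finite : (len : ℕ) → (Fin len → Fin n → Bool) → Word n
  omega  : (ℕ → Fin n → Bool) → Word n

Elem : ∀ {n} → Word n → Set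
Elem (finite len _) = Fin len
Elem (omega _)      = ℕ

pos : ∀ {n} (M : Word n) → Elem M → ℕ
pos (finite len _) a = toℕ a
pos (omega _)      a = a

lab : ∀ {n} (M : Word n) → Elem M → Fin n → Bool
lab (finite len w) a = w a
lab (omega w)      a = w a

data Atom (n s : ℕ) : Set where
  rel  : Fin n → Fin s → Atom n s
  succ : Fin s → Fin s → Atom n s
  less : Fin s → Fin s → Atom n s
  eq   : Fin s → Fin s → Atom n s

data Literal (n s : ℕ) : Set where
  pos⁺ : Atom n s → Literal n s
  neg⁻ : Atom n s → Literal n s

evalAtom : ∀ {n s} (M : Word n) → (Fin s → Elem M) → Atom n s → Bool
evalAtom M as (rel r i)  = lab M (as i) r
evalAtom M as (succ i j) = ⌊ suc (pos M (as i)) ≟ pos M (as j) ⌋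
evalAtom M as (less i j) = ⌊ pos M (as i) <? pos M (as j) ⌋
evalAtom M as (eq i j)   = ⌊ pos M (as i) ≟ pos M (as j) ⌋

evalLit : ∀ {n s} (M : Word n) → (Fin s → Elem M) → Literal n s → Bool
evalLit M as (pos⁺ a) = evalAtom M as a
evalLit M as (neg⁻ a) = not (evalAtom M as a)

-- A type in s variables is a set of literals (given by its characteristic
-- function).  tp(a₁,…,a_s) is the set of literals true under x_i ↦ a_i.
TypeSet : ℕ → ℕ → Set
TypeSet n s = Literal n s → Bool

tp : ∀ {n s} (M : Word n) → (Fin s → Elem M) → TypeSet n s
tp M as = evalLit M as

-- Tuples a₁,…,a_s with
-- 1 ≤ s ≤ k are written with s = suc s' (s' < k), a₁ = as fzero, and
-- a₂,…,a_s = as (fsuc i) for i : Fin s'.  Each component is a set of types,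
-- given as a predicate on pairs (s', t) with t a type in suc s' variables.

ProfF : ∀ {n} (M : Word n) (k : ℕ) → Elem M → (s' : ℕ) → TypeSet n (suc s') → Set
ProfF M k a s' t =
  suc s' ≤ k × Σ (Fin (suc s') → Elem M) λ as → (as fzero ≡ a) × (tp M as ≗ t)

ProfL : ∀ {n} (M : Word n) (k : ℕ) → Elem M → (s' : ℕ) → TypeSet n (suc s') → Set
ProfL M k a s' t =
  suc s' ≤ k × Σ (Fin (suc s') → Elem M) λ as → (as fzero ≡ a)
    × (∀ (i : Fin s') → pos M (as (fsuc i)) < pos M a) × (tp M as ≗ t)

ProfR : ∀ {n} (M : Word n) (k : ℕ) → Elem M → (s' : ℕ) → TypeSet n (suc s') → Set
ProfR M k a s' t =
  suc s' ≤ k × Σ (Fin (suc s') → Elem M) λ as → (as fzero ≡ a)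
    × (∀ (i : Fin s') → pos M a < pos M (as (fsuc i))) × (tp M as ≗ t)

_⇔ₛ_ : Set → Set → Set
A ⇔ₛ B = (A → B) × (B → A)

SameProfile : ∀ {n} (M : Word n) (k : ℕ) → Elem M → Elem M → Set
SameProfile {n} M k a b =
  ∀ (s' : ℕ) (t : TypeSet n (suc s')) →
    (ProfF M k a s' t ⇔ₛ ProfF M k b s' t)
    × (ProfL M k a s' t ⇔ₛ ProfL M k b s' t)
    × (ProfR M k a s' t ⇔ₛ ProfR M k b s' t)

-- "the number of distinct k-profiles realized in M is at most N":
-- any family of elements with pairwise distinct k-profiles has size ≤ N.
AtMostProfiles : ∀ {n} (M : Word n) (k N : ℕ) → Set
AtMostProfiles M k N =
  ∀ (m : ℕ) (e : Fin m → Elem M) →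
    (∀ i j → i ≢ j → ¬ SameProfile M k (e i) (e j)) → m ≤ N

-- Polynomials in two variables with natural coefficients, as lists of
-- monomials (c , i , j) ↦ c · n^i · k^j.

Poly₂ : Set
Poly₂ = List (ℕ × ℕ × ℕ)

evalPoly₂ : Poly₂ → ℕ → ℕ → ℕ
evalPoly₂ []                  n k = 0
evalPoly₂ ((c , i , j) ∷ ms) n k = c * (n ^ i) * (k ^ j) + evalPoly₂ ms n k

-- A tuple of at most k positions containing p leaves free one of the k positions just left of p and
-- one of the k just right of p. These two cuts split the tuple into a part left of the cuts, a part
-- inside the window of width 2k around p, and a part right of the cuts. Suppose q carries the same
-- labels on its window, and every atomic type of a (masked) tuple of at most k positions realized
-- left (right) of a cut near p is also realized left (right) of the corresponding cut near q. Then
-- the three parts can be moved next to q separately, the middle one by translation, and glued to a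
-- tuple containing q of the same atomic type. As p varies, the sets of types realized left of p - d
-- form a chain, so each is determined by its size, which is at most exponential in n and k. The
-- sizes, the window and the distances of p to the ends of the word form a signature with 2^poly(n,k)
-- possible values, and equal signatures give equal k-profiles.

module Submission where

open import Defs
open import Data.Bool using (Bool; true; false; not; T)
open import Data.Empty using (⊥-elim)
open import Data.Fin as Fin using (Fin; toℕ; fromℕ<; combine; funToFin; finToFun)
  renaming (zero to fzero; suc to fsuc)
open import Data.Fin.Patterns using (0F; 1F; 2F)
import Data.Fin.Properties as Finₚ
open import Data.Nat
open import Data.Nat.Properties
open import Data.Product using (Σ; Σ-syntax; ∃; _×_; _,_; proj₁; proj₂)
open import Data.Sum using (_⊎_; inj₁; inj₂)
import Data.Sum as Sum
open import Data.List using ([]; _∷_)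
open import Data.Unit using (⊤; tt)
open import Data.Vec using (tabulate)
open import Data.Vec.Properties using (lookup∘tabulate; []=⇒lookup; lookup⇒[]=)
open import Data.Fin.Subset using (Subset; _∈_; _⊆_; ∣_∣)
open import Data.Fin.Subset.Properties using (_∈?_; ∣p∣≤n; p⊂q⇒∣p∣<∣q∣)
open import Function using (_∘_)
open import Data.Nat.Tactic.RingSolver using (solve-∀)
open import Relation.Binary using (tri<; tri≈; tri>)
open import Relation.Binary.PropositionalEquality
open import Relation.Nullary using (¬_; Dec; yes; no)
open import Relation.Nullary.Negation using (¬¬-map)
open import Relation.Nullary.Decidable using (⌊_⌋; isYes; isYes≗does; ¬¬-excluded-middle; dec-true; dec-false; toWitness; fromWitness; decidable-stable; ¬?)

Valid : ∀ {n} → Word n → ℕ → Set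
Valid (finite len _) x = x < len
Valid (omega _)      _ = ⊤

-- Labels of a finite word are padded with false beyond its last position.
label : ∀ {n} → Word n → ℕ → Fin n → Bool
label (finite len w) x r with x <? len
... | yes x<len = w (fromℕ< x<len) r
... | no  _     = false
label (omega w) x r = w x r

label-pos : ∀ {n} (M : Word n) (a : Elem M) → label M (pos M a) ≗ lab M a
label-pos (finite len w) a r with toℕ a <? len
... | yes a<len = cong (λ b → w b r) (Finₚ.fromℕ<-toℕ a a<len)
... | no  a≮len = ⊥-elim (a≮len (Finₚ.toℕ<n a))
label-pos (omega w) a r = refl

valid-pos : ∀ {n} (M : Word n) (a : Elem M) → Valid M (pos M a)
valid-pos (finite len _) a = Finₚ.toℕ<n a
valid-pos (omega _)      a = tt

valid-≤ : ∀ {n} (M : Word n) {x y} → x ≤ y → Valid M y → Valid M x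
valid-≤ (finite len _) x≤y y<len = ≤-<-trans x≤y y<len
valid-≤ (omega _)      x≤y _     = tt

elemAt : ∀ {n} (M : Word n) x → Valid M x → Elem M
elemAt (finite len _) x x<len = fromℕ< x<len
elemAt (omega _)      x _     = x

pos-elemAt : ∀ {n} (M : Word n) x (v : Valid M x) → pos M (elemAt M x v) ≡ x
pos-elemAt (finite len _) x x<len = Finₚ.toℕ-fromℕ< x<len
pos-elemAt (omega _)      x _     = refl

pos-injective : ∀ {n} (M : Word n) {a b : Elem M} → pos M a ≡ pos M b → a ≡ b
pos-injective (finite len _) = Finₚ.toℕ-injective
pos-injective (omega _)      = λ a≡b → a≡b

-- the values of the atoms succ(x, y), x < y and x = y, computed exactly as in evalAtom
OrderType : Set
OrderType = Bool × Bool × Bool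

orderType : ℕ → ℕ → OrderType
orderType x y = ⌊ suc x ≟ y ⌋ , ⌊ x <? y ⌋ , ⌊ x ≟ y ⌋

⌊⌋-cong : ∀ {A B : Set} (a? : Dec A) (b? : Dec B) → (A → B) → (B → A) → ⌊ a? ⌋ ≡ ⌊ b? ⌋
⌊⌋-cong (yes a) (yes b) f g = refl
⌊⌋-cong (yes a) (no ¬b) f g = ⊥-elim (¬b (f a))
⌊⌋-cong (no ¬a) (yes b) f g = ⊥-elim (¬a (g b))
⌊⌋-cong (no ¬a) (no ¬b) f g = refl

⌊⌋-true : ∀ {A : Set} (a? : Dec A) → A → ⌊ a? ⌋ ≡ true
⌊⌋-true a? a = trans (isYes≗does a?) (dec-true a? a)

⌊⌋-false : ∀ {A : Set} (a? : Dec A) → ¬ A → ⌊ a? ⌋ ≡ false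
⌊⌋-false a? ¬a = trans (isYes≗does a?) (dec-false a? ¬a)

orderType-shift : ∀ c x y → orderType (c + x) (c + y) ≡ orderType x y
orderType-shift c x y =
  cong₂ _,_ (⌊⌋-cong (suc (c + x) ≟ c + y) (suc x ≟ y)
                       (λ e → +-cancelˡ-≡ c (suc x) y (trans (+-suc c x) e))
                       (λ e → trans (sym (+-suc c x)) (cong (c +_) e)))
  (cong₂ _,_ (⌊⌋-cong (c + x <? c + y) (x <? y) (+-cancelˡ-< c x y) (+-monoʳ-< c))
             (⌊⌋-cong (c + x ≟ c + y) (x ≟ y) (+-cancelˡ-≡ c x y) (cong (c +_))))

orderType-apart : ∀ {x y} → suc x < y → orderType x y ≡ (false , true , false)
orderType-apart {x} {y} x+1<y =
  cong₂ _,_ (⌊⌋-false (suc x ≟ y) (λ e → <-irrefl e x+1<y))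
  (cong₂ _,_ (⌊⌋-true (x <? y) x<y) (⌊⌋-false (x ≟ y) (λ e → <-irrefl e x<y)))
  where x<y = <-trans (n<1+n x) x+1<y

orderType-apart⁻ : ∀ {x y} → suc x < y → orderType y x ≡ (false , false , false)
orderType-apart⁻ {x} {y} x+1<y =
  cong₂ _,_ (⌊⌋-false (suc y ≟ x) (λ e → <-asym x<y (subst (y <_) e (n<1+n y))))
  (cong₂ _,_ (⌊⌋-false (y <? x) (<-asym x<y)) (⌊⌋-false (y ≟ x) (λ e → <-irrefl (sym e) x<y)))
  where x<y = <-trans (n<1+n x) x+1<y

InZone : ℕ → ℕ → Fin 3 → ℕ → Set
InZone g h 0F x = x < g
InZone g h 1F x = g < x × x < h
InZone g h 2F x = h < x

zone-classify : ∀ {g h x} → x ≢ g → x ≢ h → Σ (Fin 3) λ z → InZone g h z x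
zone-classify {g} {h} {x} x≢g x≢h with x <? g | h <? x
... | yes x<g | _       = 0F , x<g
... | no _    | yes h<x = 2F , h<x
... | no x≮g  | no h≮x  = 1F , ≤∧≢⇒< (≮⇒≥ x≮g) (x≢g ∘ sym) , ≤∧≢⇒< (≮⇒≥ h≮x) x≢h

zone-apart : ∀ {g h x y} {z z′ : Fin 3} → g < h →
             InZone g h z x → InZone g h z′ y → z Fin.< z′ → suc x < y
zone-apart {z = 0F} {1F} g<h x<g (g<y , _) _ = ≤-<-trans x<g g<y
zone-apart {z = 0F} {2F} g<h x<g h<y       _ = ≤-<-trans x<g (<-trans g<h h<y)
zone-apart {z = 1F} {2F} g<h (_ , x<h) h<y _ = ≤-<-trans x<h h<y
zone-apart {z = 0F} {0F} _ _ _ ()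
zone-apart {z = 1F} {0F} _ _ _ ()
zone-apart {z = 1F} {1F} _ _ _ (s≤s ())
zone-apart {z = 2F} {0F} _ _ _ ()
zone-apart {z = 2F} {1F} _ _ _ (s≤s ())
zone-apart {z = 2F} {2F} _ _ _ (s≤s (s≤s ()))

orderType-glue : ∀ {s g h g′ h′} {xs ys : Fin s → ℕ} → g < h → g′ < h′ → (zone : Fin s → Fin 3) →
  (∀ i → InZone g h (zone i) (xs i)) → (∀ i → InZone g′ h′ (zone i) (ys i)) →
  (∀ i j → zone i ≡ zone j → orderType (ys i) (ys j) ≡ orderType (xs i) (xs j)) →
  ∀ i j → orderType (ys i) (ys j) ≡ orderType (xs i) (xs j)
orderType-glue g<h g′<h′ zone src tgt within i j with Finₚ.<-cmp (zone i) (zone j)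
... | tri< i<j _ _ = trans (orderType-apart (zone-apart g′<h′ (tgt i) (tgt j) i<j))
                           (sym (orderType-apart (zone-apart g<h (src i) (src j) i<j)))
... | tri≈ _ i≡j _ = within i j i≡j
... | tri> _ _ j<i = trans (orderType-apart⁻ (zone-apart g′<h′ (tgt j) (tgt i) j<i))
                           (sym (orderType-apart⁻ (zone-apart g<h (src j) (src i) j<i)))

bit : Bool → Fin 2
bit false = 0F
bit true  = 1F

bit-injective : ∀ {a b} → bit a ≡ bit b → a ≡ b
bit-injective {false} {false} _ = refl
bit-injective {true}  {true}  _ = refl

funToFin-injective : ∀ {a c} (f g : Fin a → Fin c) → funToFin f ≡ funToFin g → f ≗ g
funToFin-injective f g e i = begin
  f i                    ≡⟨ Finₚ.finToFun-funToFin f i ⟨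
  finToFun (funToFin f) i ≡⟨ cong (λ c → finToFun c i) e ⟩
  finToFun (funToFin g) i ≡⟨ Finₚ.finToFun-funToFin g i ⟩
  g i                    ∎
  where open ≡-Reasoning

masked : ∀ {c} → Bool → Fin c → Fin (suc c)
masked false _ = fzero
masked true  i = fsuc i

masked-injective : ∀ b′ b {c} {j i : Fin c} → masked b′ j ≡ masked b i → b′ ≡ b × (T b → j ≡ i)
masked-injective false false _ = refl , λ ()
masked-injective true  true  e = refl , λ _ → Finₚ.suc-injective e

orderCode : OrderType → Fin 8
orderCode (a , b , c) = combine (bit a) (combine (bit b) (bit c))

orderCode-injective : ∀ t u → orderCode t ≡ orderCode u → t ≡ u
orderCode-injective (a , b , c) (a′ , b′ , c′) e
  with Finₚ.combine-injective (bit a) (combine (bit b) (bit c)) (bit a′) (combine (bit b′) (bit c′)) e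
... | a≡a′ , e′ with Finₚ.combine-injective (bit b) (bit c) (bit b′) (bit c′) e′
...   | b≡b′ , c≡c′ = cong₂ _,_ (bit-injective a≡a′) (cong₂ _,_ (bit-injective b≡b′) (bit-injective c≡c′))

labelCode : ∀ {n} → Word n → ℕ → Fin (2 ^ n)
labelCode M x = funToFin (bit ∘ label M x)

orderRow : ∀ {s} → (Fin s → Bool) → (Fin s → ℕ) → Fin s → Fin (9 ^ s)
orderRow m xs i = funToFin λ j → masked (m j) (orderCode (orderType (xs i) (xs j)))

maskedTypes : ℕ → ℕ → ℕ
maskedTypes n s = suc (2 ^ n * 9 ^ s) ^ s

-- The atomic type of the entries of xs selected by m, coded in Fin; unselected entries are forgotten.
maskedType : ∀ {n s} → Word n → (Fin s → Bool) → (Fin s → ℕ) → Fin (maskedTypes n s)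
maskedType M m xs = funToFin λ i → masked (m i) (combine (labelCode M (xs i)) (orderRow m xs i))

AgreeOn : ∀ {n s} → Word n → (Fin s → Bool) → (Fin s → ℕ) → (Fin s → ℕ) → Set
AgreeOn M m xs ys =
  (∀ i → T (m i) → label M (ys i) ≗ label M (xs i))
  × (∀ i j → T (m i) → T (m j) → orderType (ys i) (ys j) ≡ orderType (xs i) (xs j))

maskedType-injective : ∀ {n s} {M : Word n} {m′ m : Fin s → Bool} {ys xs : Fin s → ℕ} →
  maskedType M m′ ys ≡ maskedType M m xs → m′ ≗ m × AgreeOn M m xs ys
maskedType-injective {M = M} {m′} {m} {ys} {xs} e = masks , labels , orders
  where
  row : ∀ i → masked (m′ i) (combine (labelCode M (ys i)) (orderRow m′ ys i))
            ≡ masked (m i) (combine (labelCode M (xs i)) (orderRow m xs i))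
  row = funToFin-injective _ _ e

  masks : m′ ≗ m
  masks i = proj₁ (masked-injective (m′ i) (m i) (row i))

  payload : ∀ i → T (m i) → labelCode M (ys i) ≡ labelCode M (xs i) × orderRow m′ ys i ≡ orderRow m xs i
  payload i mi = Finₚ.combine-injective (labelCode M (ys i)) (orderRow m′ ys i) (labelCode M (xs i)) (orderRow m xs i)
                   (proj₂ (masked-injective (m′ i) (m i) (row i)) mi)

  labels : ∀ i → T (m i) → label M (ys i) ≗ label M (xs i)
  labels i mi r = bit-injective (funToFin-injective _ _ (proj₁ (payload i mi)) r)

  orders : ∀ i j → T (m i) → T (m j) → orderType (ys i) (ys j) ≡ orderType (xs i) (xs j)
  orders i j mi mj = orderCode-injective _ _
    (proj₂ (masked-injective (m′ j) (m j) (funToFin-injective _ _ (proj₂ (payload i mi)) j)) mj)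

RealizedIn : ∀ {n} → Word n → (s : ℕ) → (ℕ → Set) → Fin (maskedTypes n s) → Set
RealizedIn M s R c =
  Σ[ m ∈ (Fin s → Bool) ] Σ[ xs ∈ (Fin s → ℕ) ] (∀ i → T (m i) → R (xs i)) × maskedType M m xs ≡ c

Above : ∀ {n} → Word n → ℕ → ℕ → Set
Above M h x = h < x × Valid M x

RealizedIn-below-mono : ∀ {n s} {M : Word n} {g g′} → g ≤ g′ →
                        ∀ {c} → RealizedIn M s (_< g) c → RealizedIn M s (_< g′) c
RealizedIn-below-mono g≤g′ (m , xs , below , e) = m , xs , (λ i mi → <-≤-trans (below i mi) g≤g′) , e

RealizedIn-above-mono : ∀ {n s} {M : Word n} {h h′} → h ≤ h′ →
                        ∀ {c} → RealizedIn M s (Above M h′) c → RealizedIn M s (Above M h) c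
RealizedIn-above-mono h≤h′ (m , xs , above , e) =
  m , xs , (λ i mi → ≤-<-trans h≤h′ (proj₁ (above i mi)) , proj₂ (above i mi)) , e

RealizedIn-maskedType : ∀ {n s} (M : Word n) {R : ℕ → Set} (m : Fin s → Bool) (xs : Fin s → ℕ) →
  RealizedIn M s R (maskedType M m xs) → Σ[ ys ∈ (Fin s → ℕ) ] (∀ i → T (m i) → R (ys i)) × AgreeOn M m xs ys
RealizedIn-maskedType M m xs (m′ , ys , inR , e) with maskedType-injective {M = M} {m′} {m} {ys} {xs} e
... | m′≗m , agree = ys , (λ i mi → inR i (subst T (sym (m′≗m i)) mi)) , agree

orderType-reframe : ∀ P Q {x y} → P ≤ x → P ≤ y → orderType (Q + (x ∸ P)) (Q + (y ∸ P)) ≡ orderType x y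
orderType-reframe P Q {x} {y} P≤x P≤y = begin
  orderType (Q + (x ∸ P)) (Q + (y ∸ P)) ≡⟨ orderType-shift Q (x ∸ P) (y ∸ P) ⟩
  orderType (x ∸ P) (y ∸ P)             ≡⟨ orderType-shift P (x ∸ P) (y ∸ P) ⟨
  orderType (P + (x ∸ P)) (P + (y ∸ P)) ≡⟨ cong₂ orderType (m+[n∸m]≡n P≤x) (m+[n∸m]≡n P≤y) ⟩
  orderType x y                         ∎
  where open ≡-Reasoning

∃-avoiding : ∀ {s k} (xs : Fin s → ℕ) (c : Fin k → ℕ) → (∀ {d e} → c d ≡ c e → d ≡ e) → s < k →
             ∃ λ d → ∀ i → xs i ≢ c d
∃-avoiding {s} {k} xs c c-injective s<k with Finₚ.any? (λ d → Finₚ.all? (λ i → ¬? (xs i ≟ c d)))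
... | yes avoided = avoided
... | no  ¬avoided = ⊥-elim (<⇒≱ s<k (Finₚ.injective⇒≤ hit-injective))
  where
  hit : ∀ d → ∃ λ i → xs i ≡ c d
  hit d with Finₚ.¬∀⟶∃¬ s _ (λ i → ¬? (xs i ≟ c d)) (λ avoids → ¬avoided (d , avoids))
  ... | i , ¬≢ = i , decidable-stable (xs i ≟ c d) ¬≢

  hit-injective : ∀ {d e} → proj₁ (hit d) ≡ proj₁ (hit e) → d ≡ e
  hit-injective {d} {e} i≡j = c-injective (trans (sym (proj₂ (hit d))) (trans (cong xs i≡j) (proj₂ (hit e))))

window-below : ∀ {k p d} → k ≤ p → d ≤ k → p ∸ d ≡ p ∸ k + (k ∸ d)
window-below {k} {p} {d} k≤p d≤k = trans (cong (_∸ d) (sym (m∸n+n≡m k≤p))) (+-∸-assoc (p ∸ k) d≤k)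

window-above : ∀ {k p} e → k ≤ p → p + e ≡ p ∸ k + (k + e)
window-above {k} {p} e k≤p = trans (cong (_+ e) (sym (m∸n+n≡m k≤p))) (+-assoc (p ∸ k) k e)

Similar : ∀ {n s} → Word n → (Fin s → ℕ) → (Fin s → ℕ) → Set
Similar M xs ys =
  (∀ i → label M (ys i) ≗ label M (xs i)) × (∀ i j → orderType (ys i) (ys j) ≡ orderType (xs i) (xs j))

-- What equal signatures of p and q provide, and all that moving tuples from p to q uses.
record Indistinguishable {n} (M : Word n) (k p q : ℕ) : Set where
  field
    k≤p    : k ≤ p
    k≤q    : k ≤ q
    room   : ∀ {y} → y < q + k → Valid M y
    window : ∀ {t} → t < k + k → label M (p ∸ k + t) ≗ label M (q ∸ k + t)
    below  : ∀ {s} → s < k → (d : Fin k) → ∀ {c} →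
             RealizedIn M (suc s) (_< p ∸ suc (toℕ d)) c → RealizedIn M (suc s) (_< q ∸ suc (toℕ d)) c
    above  : ∀ {s} → s < k → (d : Fin k) → ∀ {c} →
             RealizedIn M (suc s) (Above M (p + suc (toℕ d))) c → RealizedIn M (suc s) (Above M (q + suc (toℕ d))) c

private
  module Transfer {n} {M : Word n} {k p q} (I : Indistinguishable M k p q) {s} (s<k : s < k)
                  (xs : Fin (suc s) → ℕ) (xs-valid : ∀ i → Valid M (xs i)) (xs₀ : xs fzero ≡ p) where
    open Indistinguishable I

    P Q : ℕ
    P = p ∸ k
    Q = q ∸ k

    d<k : (d : Fin k) → suc (toℕ d) ≤ k
    d<k = Finₚ.toℕ<n

    cutBelow cutAbove : ℕ → Fin k → ℕ
    cutBelow x d = x ∸ suc (toℕ d)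
    cutAbove x d = x + suc (toℕ d)

    gapBelow : ∃ λ d → ∀ i → xs (fsuc i) ≢ cutBelow p d
    gapBelow = ∃-avoiding (xs ∘ fsuc) (cutBelow p)
      (λ {d} {e} cd≡ce → Finₚ.toℕ-injective (suc-injective
        (∸-cancelˡ-≡ (≤-trans (d<k d) k≤p) (≤-trans (d<k e) k≤p) cd≡ce))) s<k

    gapAbove : ∃ λ d → ∀ i → xs (fsuc i) ≢ cutAbove p d
    gapAbove = ∃-avoiding (xs ∘ fsuc) (cutAbove p)
      (λ cd≡ce → Finₚ.toℕ-injective (suc-injective (+-cancelˡ-≡ p _ _ cd≡ce))) s<k

    dL dU : Fin k
    dL = proj₁ gapBelow
    dU = proj₁ gapAbove

    g h g′ h′ a₁ a₂ : ℕ
    g  = cutBelow p dL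
    h  = cutAbove p dU
    g′ = cutBelow q dL
    h′ = cutAbove q dU
    a₁ = k ∸ suc (toℕ dL)
    a₂ = k + suc (toℕ dU)

    g<p : g < p
    g<p = ∸-monoʳ-< z<s (≤-trans (d<k dL) k≤p)

    p<h : p < h
    p<h = m<m+n p z<s

    g<h : g < h
    g<h = <-trans g<p p<h

    g′<h′ : g′ < h′
    g′<h′ = <-trans (∸-monoʳ-< z<s (≤-trans (d<k dL) k≤q)) (m<m+n q z<s)

    P≤g : P ≤ g
    P≤g = ∸-monoʳ-≤ p (d<k dL)

    avoids-g : ∀ i → xs i ≢ g
    avoids-g fzero    xs₀≡g = <-irrefl (trans (sym xs₀≡g) xs₀) g<p
    avoids-g (fsuc i) = proj₂ gapBelow i

    avoids-h : ∀ i → xs i ≢ h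
    avoids-h fzero    xs₀≡h = <-irrefl (trans (sym xs₀) xs₀≡h) p<h
    avoids-h (fsuc i) = proj₂ gapAbove i

    located : ∀ i → Σ (Fin 3) λ z → InZone g h z (xs i)
    located i = zone-classify (avoids-g i) (avoids-h i)

    zone : Fin (suc s) → Fin 3
    zone i = proj₁ (located i)

    in-zone : ∀ i {z} → zone i ≡ z → InZone g h z (xs i)
    in-zone i refl = proj₂ (located i)

    selects : Fin 3 → Fin (suc s) → Bool
    selects z i = isYes (zone i Fin.≟ z)

    selected : ∀ {i z} → zone i ≡ z → T (selects z i)
    selected {i} {z} = fromWitness {a? = zone i Fin.≟ z}

    selected⁻ : ∀ {i z} → T (selects z i) → zone i ≡ z
    selected⁻ {i} {z} = toWitness {a? = zone i Fin.≟ z}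

    shift : ℕ → ℕ
    shift x = Q + (x ∸ P)

    P≤middle : ∀ {x} → InZone g h 1F x → P ≤ x
    P≤middle (g<x , _) = ≤-trans P≤g (<⇒≤ g<x)

    middle-offset : ∀ {x} → InZone g h 1F x → a₁ < x ∸ P × x ∸ P < a₂
    middle-offset {x} x∈@(g<x , x<h) =
      +-cancelˡ-< P a₁ (x ∸ P) (subst₂ _<_ (window-below k≤p (d<k dL)) x≡ g<x) ,
      +-cancelˡ-< P (x ∸ P) a₂ (subst₂ _<_ x≡ (window-above (suc (toℕ dU)) k≤p) x<h)
      where x≡ = sym (m+[n∸m]≡n (P≤middle x∈))

    shift-in-zone : ∀ {x} → InZone g h 1F x → InZone g′ h′ 1F (shift x)
    shift-in-zone {x} x∈ =
      subst (_< shift x) (sym (window-below k≤q (d<k dL))) (+-monoʳ-< Q (proj₁ (middle-offset x∈))) ,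
      subst (shift x <_) (sym (window-above (suc (toℕ dU)) k≤q)) (+-monoʳ-< Q (proj₂ (middle-offset x∈)))

    shift-label : ∀ {x} → InZone g h 1F x → label M (shift x) ≗ label M x
    shift-label x∈ r = sym (trans (cong (λ y → label M y r) (sym (m+[n∸m]≡n (P≤middle x∈))))
                                  (window (<-≤-trans (proj₂ (middle-offset x∈)) (+-monoʳ-≤ k (d<k dU))) r))

    lower : Σ[ ys ∈ (Fin (suc s) → ℕ) ] (∀ i → T (selects 0F i) → ys i < g′) × AgreeOn M (selects 0F) xs ys
    lower = RealizedIn-maskedType M {_< g′} (selects 0F) xs (below s<k dL (selects 0F , xs , (λ i sel → in-zone i (selected⁻ sel)) , refl))

    upper : Σ[ ys ∈ (Fin (suc s) → ℕ) ] (∀ i → T (selects 2F i) → Above M h′ (ys i)) × AgreeOn M (selects 2F) xs ys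
    upper = RealizedIn-maskedType M {Above M h′} (selects 2F) xs
      (above s<k dU (selects 2F , xs , (λ i sel → in-zone i (selected⁻ sel) , xs-valid i) , refl))

    pick : Fin 3 → Fin (suc s) → ℕ
    pick 0F = proj₁ lower
    pick 1F = shift ∘ xs
    pick 2F = proj₁ upper

    ys : Fin (suc s) → ℕ
    ys i = pick (zone i) i

    ys-in-zone : ∀ i → InZone g′ h′ (zone i) (ys i)
    ys-in-zone i = go (zone i) refl
      where
      go : ∀ z → zone i ≡ z → InZone g′ h′ z (pick z i)
      go 0F e = proj₁ (proj₂ lower) i (selected e)
      go 1F e = shift-in-zone (in-zone i e)
      go 2F e = proj₁ (proj₁ (proj₂ upper) i (selected e))

    ys-labels : ∀ i → label M (ys i) ≗ label M (xs i)
    ys-labels i = go (zone i) refl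
      where
      go : ∀ z → zone i ≡ z → label M (pick z i) ≗ label M (xs i)
      go 0F e = proj₁ (proj₂ (proj₂ lower)) i (selected e)
      go 1F e = shift-label (in-zone i e)
      go 2F e = proj₁ (proj₂ (proj₂ upper)) i (selected e)

    ys-orderType-within : ∀ i j → zone i ≡ zone j → orderType (ys i) (ys j) ≡ orderType (xs i) (xs j)
    ys-orderType-within i j zi≡zj =
      subst (λ z → orderType (ys i) (pick z j) ≡ orderType (xs i) (xs j)) zi≡zj (go (zone i) refl (sym zi≡zj))
      where
      go : ∀ z → zone i ≡ z → zone j ≡ z → orderType (pick z i) (pick z j) ≡ orderType (xs i) (xs j)
      go 0F ei ej = proj₂ (proj₂ (proj₂ lower)) i j (selected ei) (selected ej)
      go 1F ei ej = orderType-reframe P Q (P≤middle (in-zone i ei)) (P≤middle (in-zone j ej))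
      go 2F ei ej = proj₂ (proj₂ (proj₂ upper)) i j (selected ei) (selected ej)

    ys-valid : ∀ i → Valid M (ys i)
    ys-valid i = go (zone i) refl
      where
      go : ∀ z → zone i ≡ z → Valid M (pick z i)
      go 0F e = valid-≤ M (<⇒≤ (<-trans (proj₁ (proj₂ lower) i (selected e)) g′<q)) (room (m<m+n q 0<k))
        where
        0<k = ≤-<-trans z≤n s<k
        g′<q = ∸-monoʳ-< z<s (≤-trans (d<k dL) k≤q)
      go 1F e = room (<-≤-trans (proj₂ (shift-in-zone (in-zone i e))) (+-monoʳ-≤ q (d<k dU)))
      go 2F e = proj₂ (proj₁ (proj₂ upper) i (selected e))

    ys₀ : ys fzero ≡ q
    ys₀ = go (zone fzero) refl
      where
      open ≡-Reasoning
      go : ∀ z → zone fzero ≡ z → pick z fzero ≡ q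
      go 0F e = ⊥-elim (<-asym g<p (subst (_< g) xs₀ (in-zone fzero e)))
      go 1F e = begin
        Q + (xs fzero ∸ P) ≡⟨ cong (λ x → Q + (x ∸ P)) xs₀ ⟩
        Q + (p ∸ P)        ≡⟨ cong (Q +_) (m∸[m∸n]≡n k≤p) ⟩
        Q + k              ≡⟨ m∸n+n≡m k≤q ⟩
        q                  ∎
      go 2F e = ⊥-elim (<-asym p<h (subst (h <_) xs₀ (in-zone fzero e)))

    similar : Similar M xs ys
    similar = ys-labels , orderType-glue g<h g′<h′ zone (λ i → in-zone i refl) ys-in-zone ys-orderType-within

transfer : ∀ {n} {M : Word n} {k p q} → Indistinguishable M k p q → ∀ {s} → s < k →
  (xs : Fin (suc s) → ℕ) → (∀ i → Valid M (xs i)) → xs fzero ≡ p →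
  Σ[ ys ∈ (Fin (suc s) → ℕ) ] (∀ i → Valid M (ys i)) × ys fzero ≡ q × Similar M xs ys
transfer I s<k xs xs-valid xs₀ = ys , ys-valid , ys₀ , similar
  where open Transfer I s<k xs xs-valid xs₀

evalAtom-similar : ∀ {n s} (M : Word n) (as bs : Fin s → Elem M) {ys : Fin s → ℕ} →
  (∀ i → pos M (bs i) ≡ ys i) → Similar M (pos M ∘ as) ys → ∀ φ → evalAtom M bs φ ≡ evalAtom M as φ
evalAtom-similar M as bs {ys} bs≡ys (labels , orders) = atom
  where
  orders′ : ∀ i j → orderType (pos M (bs i)) (pos M (bs j)) ≡ orderType (pos M (as i)) (pos M (as j))
  orders′ i j = trans (cong₂ orderType (bs≡ys i) (bs≡ys j)) (orders i j)

  atom : ∀ φ → evalAtom M bs φ ≡ evalAtom M as φ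
  atom (rel r i) = begin
    lab M (bs i) r            ≡⟨ label-pos M (bs i) r ⟨
    label M (pos M (bs i)) r  ≡⟨ cong (λ x → label M x r) (bs≡ys i) ⟩
    label M (ys i) r          ≡⟨ labels i r ⟩
    label M (pos M (as i)) r  ≡⟨ label-pos M (as i) r ⟩
    lab M (as i) r            ∎
    where open ≡-Reasoning
  atom (succ i j) = cong proj₁ (orders′ i j)
  atom (less i j) = cong (proj₁ ∘ proj₂) (orders′ i j)
  atom (eq i j)   = cong (proj₂ ∘ proj₂) (orders′ i j)

tp-similar : ∀ {n s} (M : Word n) (as bs : Fin s → Elem M) {ys : Fin s → ℕ} →
  (∀ i → pos M (bs i) ≡ ys i) → Similar M (pos M ∘ as) ys → tp M bs ≗ tp M as
tp-similar M as bs bs≡ys similar (pos⁺ φ) = evalAtom-similar M as bs bs≡ys similar φ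
tp-similar M as bs bs≡ys similar (neg⁻ φ) = cong not (evalAtom-similar M as bs bs≡ys similar φ)

tp-preserves-< : ∀ {n s} (M : Word n) {as bs : Fin s → Elem M} → tp M bs ≗ tp M as →
  ∀ i j → pos M (as i) < pos M (as j) → pos M (bs i) < pos M (bs j)
tp-preserves-< M {as} {bs} tp≗ i j as<as =
  toWitness {a? = pos M (bs i) <? pos M (bs j)}
    (subst T (sym (tp≗ (pos⁺ (less i j)))) (fromWitness {a? = pos M (as i) <? pos M (as j)} as<as))

module _ {n} {M : Word n} {k} {a b : Elem M} (I : Indistinguishable M k (pos M a) (pos M b)) where

  transfer-tuple : ∀ {s} → s < k → (as : Fin (suc s) → Elem M) → as fzero ≡ a →
                   Σ[ bs ∈ (Fin (suc s) → Elem M) ] bs fzero ≡ b × tp M bs ≗ tp M as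
  transfer-tuple s<k as as₀ with transfer I s<k (pos M ∘ as) (valid-pos M ∘ as) (cong (pos M) as₀)
  ... | ys , ys-valid , ys₀ , similar =
    bs , pos-injective M (trans (pos-elemAt M _ (ys-valid fzero)) ys₀) ,
    tp-similar M as bs (λ i → pos-elemAt M (ys i) (ys-valid i)) similar
    where
    bs : Fin _ → Elem M
    bs i = elemAt M (ys i) (ys-valid i)

  preserves-<ˡ : ∀ {s} {as bs : Fin (suc s) → Elem M} → as fzero ≡ a → bs fzero ≡ b → tp M bs ≗ tp M as →
                 ∀ i → pos M (as i) < pos M a → pos M (bs i) < pos M b
  preserves-<ˡ {as = as} {bs} as₀ bs₀ tp≗ i as<a =
    subst (λ c → pos M (bs i) < pos M c) bs₀
      (tp-preserves-< M tp≗ i fzero (subst (λ c → pos M (as i) < pos M c) (sym as₀) as<a))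

  preserves-<ʳ : ∀ {s} {as bs : Fin (suc s) → Elem M} → as fzero ≡ a → bs fzero ≡ b → tp M bs ≗ tp M as →
                 ∀ i → pos M a < pos M (as i) → pos M b < pos M (bs i)
  preserves-<ʳ {as = as} {bs} as₀ bs₀ tp≗ i a<as =
    subst (λ c → pos M c < pos M (bs i)) bs₀
      (tp-preserves-< M tp≗ fzero i (subst (λ c → pos M c < pos M (as i)) (sym as₀) a<as))

  ProfF-transfer : ∀ s t → ProfF M k a s t → ProfF M k b s t
  ProfF-transfer s t (s<k , as , as₀ , tp≗t) with transfer-tuple s<k as as₀
  ... | bs , bs₀ , tp≗ = s<k , bs , bs₀ , λ φ → trans (tp≗ φ) (tp≗t φ)

  ProfL-transfer : ∀ s t → ProfL M k a s t → ProfL M k b s t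
  ProfL-transfer s t (s<k , as , as₀ , as<a , tp≗t) with transfer-tuple s<k as as₀
  ... | bs , bs₀ , tp≗ =
    s<k , bs , bs₀ , (λ i → preserves-<ˡ as₀ bs₀ tp≗ (fsuc i) (as<a i)) , λ φ → trans (tp≗ φ) (tp≗t φ)

  ProfR-transfer : ∀ s t → ProfR M k a s t → ProfR M k b s t
  ProfR-transfer s t (s<k , as , as₀ , a<as , tp≗t) with transfer-tuple s<k as as₀
  ... | bs , bs₀ , tp≗ =
    s<k , bs , bs₀ , (λ i → preserves-<ʳ as₀ bs₀ tp≗ (fsuc i) (a<as i)) , λ φ → trans (tp≗ φ) (tp≗t φ)

sameProfile : ∀ {n} {M : Word n} {k} {a b : Elem M} →
  Indistinguishable M k (pos M a) (pos M b) → Indistinguishable M k (pos M b) (pos M a) → SameProfile M k a b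
sameProfile I J s t =
  (ProfF-transfer I s t , ProfF-transfer J s t) ,
  (ProfL-transfer I s t , ProfL-transfer J s t) ,
  (ProfR-transfer I s t , ProfR-transfer J s t)

sameProfile-refl : ∀ {n} {M : Word n} {k} (a : Elem M) → SameProfile M k a a
sameProfile-refl a s t = ((λ x → x) , (λ x → x)) , ((λ x → x) , (λ x → x)) , ((λ x → x) , (λ x → x))

subsetOf : ∀ {N} {P : Fin N → Set} → (∀ c → Dec (P c)) → Subset N
subsetOf P? = tabulate (λ c → ⌊ P? c ⌋)

∈-subsetOf⁺ : ∀ {N} {P : Fin N → Set} (P? : ∀ c → Dec (P c)) {c} → P c → c ∈ subsetOf P?
∈-subsetOf⁺ P? {c} pc = lookup⇒[]= c (subsetOf P?) (trans (lookup∘tabulate _ c) (⌊⌋-true (P? c) pc))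

∈-subsetOf⁻ : ∀ {N} {P : Fin N → Set} (P? : ∀ c → Dec (P c)) {c} → c ∈ subsetOf P? → P c
∈-subsetOf⁻ P? {c} c∈ =
  toWitness {a? = P? c} (subst T (sym (trans (sym (lookup∘tabulate _ c)) ([]=⇒lookup c∈))) tt)

⊆-by-size : ∀ {N} {p q : Subset N} → q ⊆ p → ∣ p ∣ ≡ ∣ q ∣ → p ⊆ q
⊆-by-size {q = q} q⊆p ∣p∣≡∣q∣ {c} c∈p with c ∈? q
... | yes c∈q = c∈q
... | no  c∉q = ⊥-elim (<-irrefl (sym ∣p∣≡∣q∣) (p⊂q⇒∣p∣<∣q∣ (q⊆p , c , c∈p , c∉q)))

comparable-⊆-by-size : ∀ {N} {P Q : Fin N → Set} (P? : ∀ c → Dec (P c)) (Q? : ∀ c → Dec (Q c)) →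
  (∀ {c} → P c → Q c) ⊎ (∀ {c} → Q c → P c) → ∣ subsetOf P? ∣ ≡ ∣ subsetOf Q? ∣ → ∀ {c} → P c → Q c
comparable-⊆-by-size P? Q? (inj₁ P⊆Q) _ = P⊆Q
comparable-⊆-by-size P? Q? (inj₂ Q⊆P) ∣P∣≡∣Q∣ pc =
  ∈-subsetOf⁻ Q? (⊆-by-size (λ c∈Q → ∈-subsetOf⁺ P? (Q⊆P (∈-subsetOf⁻ Q? c∈Q))) ∣P∣≡∣Q∣ (∈-subsetOf⁺ P? pc))

maskedTypes-mono : ∀ n {s s′} → s ≤ s′ → maskedTypes n s ≤ maskedTypes n s′
maskedTypes-mono n {s} {s′} s≤s′ =
  ≤-trans (^-monoʳ-≤ (suc (2 ^ n * 9 ^ s)) s≤s′) (^-monoˡ-≤ s′ (s≤s (*-monoʳ-≤ (2 ^ n) (^-monoʳ-≤ 9 s≤s′))))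

⊓-capped : ∀ {k x y} → x ⊓ k ≡ y ⊓ k → x ≡ y ⊎ (k ≤ x × k ≤ y)
⊓-capped {k} {x} {y} e with ≤-total x k | ≤-total y k
... | inj₁ x≤k | inj₁ y≤k = inj₁ (trans (sym (m≤n⇒m⊓n≡m x≤k)) (trans e (m≤n⇒m⊓n≡m y≤k)))
... | inj₁ x≤k | inj₂ k≤y = inj₂ (≤-reflexive (trans (sym (m≥n⇒m⊓n≡n k≤y)) (trans (sym e) (m≤n⇒m⊓n≡m x≤k))) , k≤y)
... | inj₂ k≤x | inj₁ y≤k = inj₂ (k≤x , ≤-reflexive (trans (sym (m≥n⇒m⊓n≡n k≤x)) (trans e (m≤n⇒m⊓n≡m y≤k))))
... | inj₂ k≤x | inj₂ k≤y = inj₂ (k≤x , k≤y)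

capped : ∀ k → ℕ → Fin (suc k)
capped k x = fromℕ< (s≤s (m⊓n≤n x k))

capped-injective : ∀ k {x y} → capped k x ≡ capped k y → x ≡ y ⊎ (k ≤ x × k ≤ y)
capped-injective k e = ⊓-capped (trans (sym (Finₚ.toℕ-fromℕ< _)) (trans (cong toℕ e) (Finₚ.toℕ-fromℕ< _)))

HasRoom : ∀ {n} → Word n → ℕ → ℕ → Set
HasRoom M k x = ∀ {y} → y < x + k → Valid M y

finite-room : ∀ {n len k x} {w : Fin len → Fin n → Bool} → x < len → k ≤ len ∸ suc x → HasRoom (finite len w) k x
finite-room {len = len} {k} {x} x<len k≤len∸x+1 y<x+k = <-trans y<x+k (begin-strict
  x + k                   ≤⟨ +-monoʳ-≤ x k≤len∸x+1 ⟩
  x + (len ∸ suc x)       <⟨ n<1+n _ ⟩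
  suc x + (len ∸ suc x)   ≡⟨ m+[n∸m]≡n x<len ⟩
  len                     ∎)
  where open ≤-Reasoning

roomCap : ∀ {n} k → Word n → ℕ → Fin (suc k)
roomCap k (finite len _) x = capped k (len ∸ suc x)
roomCap k (omega _)      x = capped k k

roomCap-injective : ∀ {n} k (M : Word n) {x y} → Valid M x → Valid M y → roomCap k M x ≡ roomCap k M y →
                    x ≡ y ⊎ (HasRoom M k x × HasRoom M k y)
roomCap-injective k (finite len w) x<len y<len e with capped-injective k e
... | inj₁ e′              = inj₁ (suc-injective (∸-cancelˡ-≡ x<len y<len e′))
... | inj₂ (k≤room , k≤room′) = inj₂ (finite-room {w = w} x<len k≤room , finite-room {w = w} y<len k≤room′)
roomCap-injective k (omega _) _ _ _ = inj₂ ((λ _ → tt) , (λ _ → tt))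

record Signature (n k : ℕ) : Set where
  field
    leftCap rightCap        : Fin (suc k)
    window                  : Fin (k + k) → Fin n → Bool
    belowCounts aboveCounts : Fin k → Fin k → Fin (suc (maskedTypes n k))
open Signature

signatures : ℕ → ℕ → ℕ
signatures n k = suc k * (suc k * ((2 ^ n) ^ (k + k) * ((B ^ k) ^ k * (B ^ k) ^ k)))
  where B = suc (maskedTypes n k)

funToFin₂ : ∀ {a b c} → (Fin a → Fin b → Fin c) → Fin ((c ^ b) ^ a)
funToFin₂ f = funToFin (funToFin ∘ f)

funToFin₂-injective : ∀ {a b c} (f g : Fin a → Fin b → Fin c) → funToFin₂ f ≡ funToFin₂ g → ∀ i j → f i j ≡ g i j
funToFin₂-injective f g e i = funToFin-injective (f i) (g i) (funToFin-injective (funToFin ∘ f) (funToFin ∘ g) e i)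

windowCode : ∀ {n k} → Signature n k → Fin ((2 ^ n) ^ (k + k))
windowCode σ = funToFin₂ λ t r → bit (window σ t r)

encode : ∀ {n k} → Signature n k → Fin (signatures n k)
encode σ = combine (leftCap σ) (combine (rightCap σ)
             (combine (windowCode σ) (combine (funToFin₂ (belowCounts σ)) (funToFin₂ (aboveCounts σ)))))

encode-injective : ∀ {n k} (σ τ : Signature n k) → encode σ ≡ encode τ →
  leftCap σ ≡ leftCap τ × rightCap σ ≡ rightCap τ × (∀ t r → window σ t r ≡ window τ t r)
  × (∀ s d → belowCounts σ s d ≡ belowCounts τ s d) × (∀ s d → aboveCounts σ s d ≡ aboveCounts τ s d)
encode-injective σ τ e
  with Finₚ.combine-injective (leftCap σ) _ (leftCap τ) _ e
... | eL , e₁ with Finₚ.combine-injective (rightCap σ) _ (rightCap τ) _ e₁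
... | eR , e₂ with Finₚ.combine-injective (windowCode σ) _ (windowCode τ) _ e₂
... | eW , e₃ with Finₚ.combine-injective (funToFin₂ (belowCounts σ)) _ (funToFin₂ (belowCounts τ)) _ e₃
... | eB , eA =
  eL , eR , (λ t r → bit-injective (funToFin₂-injective _ _ eW t r)) ,
  funToFin₂-injective _ _ eB , funToFin₂-injective _ _ eA

-- Realization above a position of an ω-word is not decidable, so decisions exist only under ¬¬
-- (¬¬-decisions); this suffices because the bound being proved is decidable.
Decisions : ∀ {n} → Word n → ℕ → ℕ → Set
Decisions M k p = ∀ (s d : Fin k) →
  (∀ c → Dec (RealizedIn M (suc (toℕ s)) (_< p ∸ suc (toℕ d)) c))
  × (∀ c → Dec (RealizedIn M (suc (toℕ s)) (Above M (p + suc (toℕ d))) c))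

count : ∀ {n k} (s : Fin k) {P : Fin (maskedTypes n (suc (toℕ s))) → Set} → (∀ c → Dec (P c)) →
        Fin (suc (maskedTypes n k))
count {n} s P? = fromℕ< (s≤s (≤-trans (∣p∣≤n (subsetOf P?)) (maskedTypes-mono n (Finₚ.toℕ<n s))))

count-injective : ∀ {n k} (s : Fin k) {P Q : Fin (maskedTypes n (suc (toℕ s))) → Set}
  (P? : ∀ c → Dec (P c)) (Q? : ∀ c → Dec (Q c)) → count {n} s P? ≡ count {n} s Q? → ∣ subsetOf P? ∣ ≡ ∣ subsetOf Q? ∣
count-injective {n} s P? Q? e = trans (sym (Finₚ.toℕ-fromℕ< _)) (trans (cong toℕ e) (Finₚ.toℕ-fromℕ< _))

signature : ∀ {n} (M : Word n) k p → Decisions M k p → Signature n k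
signature {n} M k p D = record
  { leftCap     = capped k p
  ; rightCap    = roomCap k M p
  ; window      = λ t → label M (p ∸ k + toℕ t)
  ; belowCounts = λ s d → count {n} s (proj₁ (D s d))
  ; aboveCounts = λ s d → count {n} s (proj₂ (D s d))
  }

fromFin : ∀ {k} (F : ℕ → Set) → (∀ (i : Fin k) → F (toℕ i)) → ∀ {i} → i < k → F i
fromFin F f i<k = subst F (Finₚ.toℕ-fromℕ< i<k) (f (fromℕ< i<k))

indistinguishable : ∀ {n} {M : Word n} {k p q} (Dp : Decisions M k p) (Dq : Decisions M k q) →
  k ≤ p → k ≤ q → HasRoom M k q →
  (∀ t r → window (signature M k p Dp) t r ≡ window (signature M k q Dq) t r) →
  (∀ s d → belowCounts (signature M k p Dp) s d ≡ belowCounts (signature M k q Dq) s d) →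
  (∀ s d → aboveCounts (signature M k p Dp) s d ≡ aboveCounts (signature M k q Dq) s d) →
  Indistinguishable M k p q
indistinguishable {n} {M} {k} {p} {q} Dp Dq k≤p k≤q room window≡ below≡ above≡ = record
  { k≤p    = k≤p
  ; k≤q    = k≤q
  ; room   = room
  ; window = fromFin (λ t → label M (p ∸ k + t) ≗ label M (q ∸ k + t)) window≡
  ; below  = λ s<k d → fromFin (λ s → ∀ {c} → RealizedIn M (suc s) (_< p ∸ suc (toℕ d)) c
                                            → RealizedIn M (suc s) (_< q ∸ suc (toℕ d)) c)
                               (λ s → below-at s d) s<k
  ; above  = λ s<k d → fromFin (λ s → ∀ {c} → RealizedIn M (suc s) (Above M (p + suc (toℕ d))) c
                                            → RealizedIn M (suc s) (Above M (q + suc (toℕ d))) c)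
                               (λ s → above-at s d) s<k
  }
  where
  below-at : ∀ (s d : Fin k) {c} → RealizedIn M (suc (toℕ s)) (_< p ∸ suc (toℕ d)) c
                                 → RealizedIn M (suc (toℕ s)) (_< q ∸ suc (toℕ d)) c
  below-at s d = comparable-⊆-by-size (proj₁ (Dp s d)) (proj₁ (Dq s d))
    (Sum.map (λ p≤q → RealizedIn-below-mono {M = M} (∸-monoˡ-≤ (suc (toℕ d)) p≤q))
             (λ q≤p → RealizedIn-below-mono {M = M} (∸-monoˡ-≤ (suc (toℕ d)) q≤p))
             (≤-total p q))
    (count-injective {n} s (proj₁ (Dp s d)) (proj₁ (Dq s d)) (below≡ s d))

  above-at : ∀ (s d : Fin k) {c} → RealizedIn M (suc (toℕ s)) (Above M (p + suc (toℕ d))) c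
                                 → RealizedIn M (suc (toℕ s)) (Above M (q + suc (toℕ d))) c
  above-at s d = comparable-⊆-by-size (proj₂ (Dp s d)) (proj₂ (Dq s d))
    (Sum.swap (Sum.map (λ p≤q → RealizedIn-above-mono {M = M} (+-monoˡ-≤ (suc (toℕ d)) p≤q))
                       (λ q≤p → RealizedIn-above-mono {M = M} (+-monoˡ-≤ (suc (toℕ d)) q≤p))
                       (≤-total p q)))
    (count-injective {n} s (proj₂ (Dp s d)) (proj₂ (Dq s d)) (above≡ s d))

sameProfile-by-signature : ∀ {n} {M : Word n} {k} {a b : Elem M}
  (Da : Decisions M k (pos M a)) (Db : Decisions M k (pos M b)) →
  encode (signature M k (pos M a) Da) ≡ encode (signature M k (pos M b) Db) → SameProfile M k a b
sameProfile-by-signature {M = M} {k} {a} {b} Da Db e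
  with encode-injective (signature M k (pos M a) Da) (signature M k (pos M b) Db) e
... | eL , eR , eW , eB , eA
  with capped-injective k eL | roomCap-injective k M (valid-pos M a) (valid-pos M b) eR
... | inj₁ a≡b | _        = subst (SameProfile M k a) (pos-injective M a≡b) (sameProfile-refl a)
... | inj₂ _   | inj₁ a≡b = subst (SameProfile M k a) (pos-injective M a≡b) (sameProfile-refl a)
... | inj₂ (k≤a , k≤b) | inj₂ (room-a , room-b) =
  sameProfile (indistinguishable Da Db k≤a k≤b room-b eW eB eA)
              (indistinguishable Db Da k≤b k≤a room-a (λ t r → sym (eW t r)) (λ s d → sym (eB s d)) (λ s d → sym (eA s d)))

¬¬-∀-Fin : ∀ {m} {P : Fin m → Set} → (∀ i → ¬ ¬ P i) → ¬ ¬ (∀ i → P i)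
¬¬-∀-Fin {zero}  _   ¬all = ¬all λ ()
¬¬-∀-Fin {suc m} ¬¬P ¬all =
  ¬¬P fzero λ p₀ → ¬¬-∀-Fin (¬¬P ∘ fsuc) λ ps → ¬all λ { fzero → p₀ ; (fsuc i) → ps i }

¬¬-× : ∀ {A B : Set} → ¬ ¬ A → ¬ ¬ B → ¬ ¬ (A × B)
¬¬-× ¬¬a ¬¬b ¬a×b = ¬¬a λ a → ¬¬b λ b → ¬a×b (a , b)

¬¬-decisions : ∀ {n} (M : Word n) k p → ¬ ¬ Decisions M k p
¬¬-decisions M k p = ¬¬-∀-Fin λ s → ¬¬-∀-Fin λ d →
  ¬¬-× (¬¬-∀-Fin λ c → ¬¬-excluded-middle) (¬¬-∀-Fin λ c → ¬¬-excluded-middle)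

atMostProfiles : ∀ {n} (M : Word n) k → AtMostProfiles M k (signatures n k)
atMostProfiles {n} M k m e distinct =
  decidable-stable (m ≤? signatures n k) (¬¬-map injection (¬¬-∀-Fin λ i → ¬¬-decisions M k (pos M (e i))))
  where
  injection : (∀ i → Decisions M k (pos M (e i))) → m ≤ signatures n k
  injection D = Finₚ.injective⇒≤ {f = code} code-injective
    where
    code : Fin m → Fin (signatures n k)
    code i = encode (signature M k (pos M (e i)) (D i))

    code-injective : ∀ {i j} → code i ≡ code j → i ≡ j
    code-injective {i} {j} codeᵢ≡codeⱼ =
      decidable-stable (i Fin.≟ j) λ i≢j → distinct i j i≢j (sameProfile-by-signature (D i) (D j) codeᵢ≡codeⱼ)

*-≤2^ : ∀ {a b} x {y} → a ≤ 2 ^ x → b ≤ 2 ^ y → a * b ≤ 2 ^ (x + y)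
*-≤2^ x {y} a≤ b≤ = ≤-trans (*-mono-≤ a≤ b≤) (≤-reflexive (sym (^-distribˡ-+-* 2 x y)))

^-≤2^ : ∀ {a} x s → a ≤ 2 ^ x → a ^ s ≤ 2 ^ (x * s)
^-≤2^ x s a≤ = ≤-trans (^-monoˡ-≤ s a≤) (≤-reflexive (^-*-assoc 2 x s))

suc-≤2^ : ∀ {a} x → a ≤ 2 ^ x → suc a ≤ 2 ^ suc x
suc-≤2^ x a≤ = ≤-trans (+-mono-≤ (m^n>0 2 x) a≤) (≤-reflexive (cong (2 ^ x +_) (sym (+-identityʳ (2 ^ x)))))

n<2^n : ∀ n → n < 2 ^ n
n<2^n zero    = ≤-refl
n<2^n (suc n) = suc-≤2^ n (n<2^n n)

signatureBits : ℕ → ℕ → ℕ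
signatureBits n k = k + (k + (n * (k + k) + (b * k * k + b * k * k)))
  where b = 1 + (1 + (n + 4 * k)) * k

signatures≤2^signatureBits : ∀ n k → signatures n k ≤ 2 ^ signatureBits n k
signatures≤2^signatureBits n k =
  *-≤2^ k (n<2^n k) (*-≤2^ k (n<2^n k)
    (*-≤2^ (n * (k + k)) (^-≤2^ n (k + k) ≤-refl) (*-≤2^ (b * k * k) countsBound countsBound)))
  where
  b = 1 + (1 + (n + 4 * k)) * k

  maskedTypesBound : maskedTypes n k ≤ 2 ^ ((1 + (n + 4 * k)) * k)
  maskedTypesBound = ^-≤2^ (1 + (n + 4 * k)) k (suc-≤2^ (n + 4 * k) (*-≤2^ n ≤-refl (^-≤2^ 4 k (m≤m+n 9 7))))

  countsBound : (suc (maskedTypes n k) ^ k) ^ k ≤ 2 ^ (b * k * k)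
  countsBound = ^-≤2^ (b * k) k (^-≤2^ b k (suc-≤2^ ((1 + (n + 4 * k)) * k) maskedTypesBound))

signaturePoly : Poly₂
signaturePoly = (2 , 0 , 1) ∷ (2 , 1 , 1) ∷ (2 , 0 , 2) ∷ (2 , 0 , 3) ∷ (2 , 1 , 3) ∷ (8 , 0 , 4) ∷ []

signatureBits≡signaturePoly : ∀ n k → signatureBits n k ≡ evalPoly₂ signaturePoly n k
signatureBits≡signaturePoly = unfolded
  where
  -- both sides unfolded to terms the ring solver can read
  unfolded : ∀ n k →
    k + (k + (n * (k + k) + ((1 + (1 + (n + 4 * k)) * k) * k * k + (1 + (1 + (n + 4 * k)) * k) * k * k)))
    ≡ 2 * 1 * (k * 1) + (2 * (n * 1) * (k * 1) + (2 * 1 * (k * (k * 1)) + (2 * 1 * (k * (k * (k * 1)))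
      + (2 * (n * 1) * (k * (k * (k * 1))) + (8 * 1 * (k * (k * (k * (k * 1)))) + 0)))))
  unfolded = solve-∀

lemma4p1 : Σ (ℕ → ℕ → ℕ) λ f →
    (Σ Poly₂ λ p → ∀ (n k : ℕ) → f n k ≤ 2 ^ evalPoly₂ p n k)
    × (∀ (n : ℕ) (M : Word n) (k : ℕ) → 0 < k → AtMostProfiles M k (f n k))
lemma4p1 =
  signatures ,
  (signaturePoly , λ n k → subst (λ e → signatures n k ≤ 2 ^ e) (signatureBits≡signaturePoly n k)
                                 (signatures≤2^signatureBits n k)) ,
  λ n M k _ → atMostProfiles M k   -- k = 0 needs no special treatment
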